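{- Let $\mathbf k\in(\mathbb N\cup\{\infty\})^\ell$. The ideal $\mathcal I\mathcal E^{\mathbf k}\subseteq\mathrm{NSym}^{(\ell)}$ is the two-sided ideal generated by $\{S_{\mathbf n}:\mathbf 0<\mathbf n\le\mathbf k,\ |\mathbf n|\text{ odd}\}$, and the $\mathbf k$-even subalgebra $\mathcal E^{\mathbf k}\subseteq\mathrm{QSym}^{(\ell)}$ is the $\mathbb Q$-span of those $M_{(\mathbf i_1,\dots,\mathbf i_m)}$ such that for every $r$, $\mathbf i_r\le\mathbf k$ implies $|\mathbf i_r|$ even.
   Context: Fix $\ell\ge1$; $|\mathbf n|=\sum n_i$, coordinatewise order on $(\mathbb N\cup\{\infty\})^\ell$. $\mathrm{QSym}^{(\ell)}$ is the $\mathbb Q$-span of $M_{\mathbf I}=\sum_{j_1<\dots<j_m}\mathbf x_{j_1}^{\mathbf i_1}\cdots\mathbf x_{j_m}^{\mathbf i_m}$ over vector compositions $\mathbf I=(\mathbf i_1,\dots,\mathbf i_m)$ (sequences of nonzero elements of $\mathbb N^\ell$) in commuting variables $x_j^{(i)}$ ($\mathbf x_j^{\mathbf n}=\prod_i(x_j^{(i)})^{n_i}$), a graded Hopf algebra with product of power series and deconcatenation coproduct. $\mathrm{NSym}^{(\ell)}$ is the graded dual, with basis $S^{\mathbf I}$ dual to $M_{\mathbf I}$, $S_{\mathbf n}=S^{(\mathbf n)}$, and $S^{\mathbf I}=S_{\mathbf i_1}\cdots S_{\mathbf i_m}$. $\zeta_{\mathcal Q}(M_{\mathbf I})=1$ if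 $\mathbf I$ has length $\le1$, else $0$ (so its degree-$\mathbf n$ part is $S_{\mathbf n}$); $\bar\zeta_{\mathcal Q}(h)=(-1)^{|\mathbf n|}\zeta_{\mathcal Q}(h)$ on degree $\mathbf n$. $\mathcal I\mathcal E^{\mathbf k}$ is the ideal of $\mathrm{NSym}^{(\ell)}$ generated by $(\bar\zeta_{\mathcal Q})_{\mathbf n}-(\zeta_{\mathcal Q})_{\mathbf n}$ for $\mathbf n\le\mathbf k$ (subscript = restriction to degree $\mathbf n$). $\mathcal E^{\mathbf k}$ is the largest graded subcoalgebra $C$ of $\mathrm{QSym}^{(\ell)}$ with $\bar\zeta_{\mathcal Q}(h)=\zeta_{\mathcal Q}(h)$ for all $h\in C$ of degree $\le\mathbf k$. -}

module Defs where

open import Data.Nat as ℕ using (ℕ; zero; suc; _≤_; _%_)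
open import Data.Bool using (Bool; true; false; T; _∨_)
open import Data.Unit using (⊤; tt)
open import Data.Fin using (Fin)
open import Data.Vec as Vec using (Vec; []; _∷_; lookup; zipWith; replicate)
import Data.Vec.Properties as VecP
open import Data.List as List using (List; []; _∷_; _++_; length; take; drop; filter; concatMap; upTo)
import Data.List.Properties as ListP
open import Data.List.Relation.Unary.All using (All)
open import Data.Product using (Σ; ∃; _×_; _,_; proj₁; proj₂)
open import Data.Rational as ℚ using (ℚ; 0ℚ; 1ℚ; _+_; _*_; -_)
open import Relation.Binary.PropositionalEquality using (_≡_; refl; _≢_; subst; sym)
open import Relation.Nullary using (Dec; yes; no; ¬_)
open import Relation.Nullary.Decidable using (does; _×-dec_)
open import Relation.Binary.Definitions using (DecidableEquality)

data ℕ∞ : Set where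
  fin : ℕ → ℕ∞
  ∞   : ℕ∞

_≤∞_ : ℕ → ℕ∞ → Set
m ≤∞ fin k = m ≤ k
m ≤∞ ∞     = ⊤

Even : ℕ → Set
Even m = m % 2 ≡ 0

Odd : ℕ → Set
Odd m = m % 2 ≡ 1

negOnePow : ℕ → ℚ
negOnePow zero    = 1ℚ
negOnePow (suc m) = - negOnePow m

module _ {ℓ : ℕ} where

  _≤ᵛ_ : Vec ℕ ℓ → Vec ℕ∞ ℓ → Set
  n ≤ᵛ k = ∀ (i : Fin ℓ) → lookup n i ≤∞ lookup k i

∣_∣ᵛ : ∀ {ℓ} → Vec ℕ ℓ → ℕ
∣ v ∣ᵛ = Vec.sum v

isNZ : ∀ {ℓ} → Vec ℕ ℓ → Bool
isNZ []            = false
isNZ (zero  ∷ v)   = isNZ v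
isNZ (suc _ ∷ v)   = true

-- a nonzero element of ℕ^ℓ (a "letter" of a vector composition)
Letter : ℕ → Set
Letter ℓ = Σ (Vec ℕ ℓ) (λ v → T (isNZ v))

T-irr : ∀ {b} (p q : T b) → p ≡ q
T-irr {true} tt tt = refl

_≟L_ : ∀ {ℓ} → DecidableEquality (Letter ℓ)
(u , p) ≟L (v , q) with VecP.≡-dec ℕ._≟_ u v
... | yes refl with T-irr p q
...   | refl = yes refl
(u , p) ≟L (v , q) | no u≢v = no λ { refl → u≢v refl }

VComp : ℕ → Set
VComp ℓ = List (Letter ℓ)

_≟C_ : ∀ {ℓ} → DecidableEquality (VComp ℓ)
_≟C_ = ListP.≡-dec _≟L_

deg : ∀ {ℓ} → VComp ℓ → Vec ℕ ℓ
deg {ℓ} []      = replicate ℓ 0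
deg (i ∷ I)     = zipWith ℕ._+_ (proj₁ i) (deg I)

-- QSym^(ℓ): finite ℚ-linear combinations of the M_I (formal sums),
-- compared by coefficients.

QSym : ℕ → Set
QSym ℓ = List (ℚ × VComp ℓ)

sumℚ : List ℚ → ℚ
sumℚ = List.foldr _+_ 0ℚ

coeff : ∀ {ℓ} → QSym ℓ → VComp ℓ → ℚ
coeff h I = sumℚ (List.map proj₁ (filter (λ t → proj₂ t ≟C I) h))

_≃_ : ∀ {ℓ} → QSym ℓ → QSym ℓ → Set
h ≃ g = ∀ I → coeff h I ≡ coeff g I

-- QSym^(ℓ) ⊗ QSym^(ℓ): formal sums of M_J ⊗ M_K
QSym² : ℕ → Set
QSym² ℓ = List (ℚ × VComp ℓ × VComp ℓ)

coeff² : ∀ {ℓ} → QSym² ℓ → VComp ℓ → VComp ℓ → ℚ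
coeff² t J K =
  sumℚ (List.map proj₁
    (filter (λ s → (proj₁ (proj₂ s) ≟C J) ×-dec (proj₂ (proj₂ s) ≟C K)) t))

_≃²_ : ∀ {ℓ} → QSym² ℓ → QSym² ℓ → Set
t ≃² u = ∀ J K → coeff² t J K ≡ coeff² u J K

module _ {ℓ : ℕ} where

  scale : ℚ → QSym ℓ → QSym ℓ
  scale a = List.map (λ t → (a * proj₁ t , proj₂ t))

  -- sum of elements = concatenation of formal sums; 0 = []
  _⊗_ : QSym ℓ → QSym ℓ → QSym² ℓ
  c ⊗ d = concatMap (λ s → List.map (λ t → (proj₁ s * proj₁ t , proj₂ s , proj₂ t)) d) c

  Δ : QSym ℓ → QSym² ℓ
  Δ = concatMap (λ s → List.map (λ j → (proj₁ s , take j (proj₂ s) , drop j (proj₂ s)))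
                                (upTo (suc (length (proj₂ s)))))

  component : Vec ℕ ℓ → QSym ℓ → QSym ℓ
  component n = filter (λ t → VecP.≡-dec ℕ._≟_ (deg (proj₂ t)) n)

  Homogeneous : Vec ℕ ℓ → QSym ℓ → Set
  Homogeneous n h = h ≃ component n h

  ζM : VComp ℓ → ℚ
  ζM []          = 1ℚ
  ζM (_ ∷ [])    = 1ℚ
  ζM (_ ∷ _ ∷ _) = 0ℚ

  ζQ : QSym ℓ → ℚ
  ζQ h = sumℚ (List.map (λ t → proj₁ t * ζM (proj₂ t)) h)

  ζ̄Q : QSym ℓ → ℚ
  ζ̄Q h = sumℚ (List.map (λ t → proj₁ t * (negOnePow ∣ deg (proj₂ t) ∣ᵛ * ζM (proj₂ t))) h)

  IsSubspace : (QSym ℓ → Set) → Set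
  IsSubspace C =
      (∀ h g → h ≃ g → C h → C g)
    × C []
    × (∀ h g → C h → C g → C (h ++ g))
    × (∀ a h → C h → C (scale a h))

  IsGraded : (QSym ℓ → Set) → Set
  IsGraded C = ∀ n h → C h → C (component n h)

  InTensor : (QSym ℓ → Set) → QSym² ℓ → Set
  InTensor C t = Σ (List (QSym ℓ × QSym ℓ)) λ ps →
      All (λ p → C (proj₁ p) × C (proj₂ p)) ps
    × t ≃² concatMap (λ p → proj₁ p ⊗ proj₂ p) ps

  IsSubcoalgebra : (QSym ℓ → Set) → Set
  IsSubcoalgebra C = ∀ h → C h → InTensor C (Δ h)

  ZetaEven : Vec ℕ∞ ℓ → (QSym ℓ → Set) → Set
  ZetaEven k C = ∀ n h → n ≤ᵛ k → Homogeneous n h → C h → ζ̄Q h ≡ ζQ h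

  Admissible : Vec ℕ∞ ℓ → (QSym ℓ → Set) → Set
  Admissible k C = IsSubspace C × IsGraded C × IsSubcoalgebra C × ZetaEven k C

  -- 𝓔^k is the largest admissible C : "E is 𝓔^k" means
  IsLargestAdmissible : Vec ℕ∞ ℓ → (QSym ℓ → Set) → Set₁
  IsLargestAdmissible k E = Admissible k E × (∀ C → Admissible k C → ∀ h → C h → E h)

  GoodComp : Vec ℕ∞ ℓ → VComp ℓ → Set
  GoodComp k I = All (λ i → proj₁ i ≤ᵛ k → Even ∣ proj₁ i ∣ᵛ) I

  EvenSpan : Vec ℕ∞ ℓ → QSym ℓ → Set
  EvenSpan k h = ∀ I → coeff h I ≢ 0ℚ → GoodComp k I

-- NSym^(ℓ): finite ℚ-linear combinations of the S^I, with
-- S^I S^J = S^{IJ};  S_n = S^{(n)} for n ≠ 0, S_0 = S^() = 1.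

NSym : ℕ → Set
NSym ℓ = List (ℚ × VComp ℓ)

module _ {ℓ : ℕ} where

  _·_ : NSym ℓ → NSym ℓ → NSym ℓ
  a · b = concatMap (λ s → List.map (λ t → (proj₁ s * proj₁ t , proj₂ s ++ proj₂ t)) b) a

  S : Vec ℕ ℓ → NSym ℓ
  S n with isNZ n in eq
  ... | true  = (1ℚ , ((n , subst T (sym eq) tt) ∷ [])) ∷ []
  ... | false = (1ℚ , []) ∷ []

  -- degree-n parts of ζ_Q and ζ̄_Q as elements of NSym^(ℓ)
  ζN : Vec ℕ ℓ → NSym ℓ
  ζN n = S n

  ζ̄N : Vec ℕ ℓ → NSym ℓ
  ζ̄N n = scale (negOnePow ∣ n ∣ᵛ) (S n)

  _−N_ : NSym ℓ → NSym ℓ → NSym ℓ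
  a −N b = a ++ scale (- 1ℚ) b

  InIdeal : (NSym ℓ → Set) → NSym ℓ → Set
  InIdeal G x = Σ (List (NSym ℓ × NSym ℓ × NSym ℓ)) λ ts →
      All (λ t → G (proj₁ (proj₂ t))) ts
    × x ≃ concatMap (λ t → (proj₁ t · proj₁ (proj₂ t)) · proj₂ (proj₂ t)) ts

  GenIE : Vec ℕ∞ ℓ → NSym ℓ → Set
  GenIE k g = ∃ λ n → n ≤ᵛ k × g ≡ (ζ̄N n −N ζN n)

  GenOdd : Vec ℕ∞ ℓ → NSym ℓ → Set
  GenOdd k g = ∃ λ n → T (isNZ n) × n ≤ᵛ k × Odd ∣ n ∣ᵛ × g ≡ S n

-- Ideals: a sandwich a·g·b is linear in g and the generator
-- ζ̄_n − ζ_n equals ((-1)^|n| − 1) S_n, so the two generating sets express each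
-- other.  Admissibility of the even span: Δ M_I only involves prefixes and
-- suffixes of I, and ζ̄ = ζ on good compositions of degree ≤ k.  Maximality:
-- slicing an element of an admissible C by coefficient functionals isolates a
-- single letter i; if |i| is odd then ζ̄ = −ζ on its degree-i part, so it vanishes.
module Submission where

open import Defs
open import Data.Nat as ℕ using (ℕ; zero; suc; _≤_; _<_; s≤s; _%_)
import Data.Nat.Properties as ℕP
import Data.Nat.DivMod as ℕDM
open import Data.Bool using (Bool; true; false; T; _∧_)
open import Data.Unit using (tt)
open import Data.Vec as Vec using (Vec; []; _∷_)
import Data.Vec.Properties as VecP
open import Data.List as List using (List; []; _∷_; _++_; length; filter; concat; concatMap; take; drop; upTo)
import Data.List.Properties as ListP
open import Data.List.Relation.Unary.All as All using (All; []; _∷_)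
import Data.List.Relation.Unary.All.Properties as AllP
open import Data.Product using (Σ; _×_; _,_; proj₁; proj₂)
open import Data.Sum using (_⊎_; inj₁; inj₂)
open import Data.Empty using (⊥-elim)
open import Data.Rational using (ℚ; 0ℚ; 1ℚ; _+_; _*_; -_; ½)
import Data.Rational.Properties as ℚP
open import Data.Rational.Solver using (module +-*-Solver)
open +-*-Solver using (solve; _:=_; _:+_; _:*_; :-_; con)
open import Relation.Binary.PropositionalEquality
open import Relation.Binary.Definitions using (DecidableEquality)
open import Relation.Nullary using (Dec; yes; no; ¬?)
open import Relation.Nullary.Decidable using (does; map′; _×-dec_)

when : Bool → ℚ → ℚ
when true  q = q
when false q = 0ℚ

when-0 : ∀ b → when b 0ℚ ≡ 0ℚ
when-0 true  = refl
when-0 false = refl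

module Evaluation {A : Set} where

  eval : (A → ℚ) → List (ℚ × A) → ℚ
  eval f []             = 0ℚ
  eval f ((a , x) ∷ h) = a * f x + eval f h

  eval-++ : ∀ f h g → eval f (h ++ g) ≡ eval f h + eval f g
  eval-++ f []             g = sym (ℚP.+-identityˡ _)
  eval-++ f ((a , x) ∷ h) g =
    trans (cong (a * f x +_) (eval-++ f h g)) (sym (ℚP.+-assoc (a * f x) (eval f h) (eval f g)))

  eval-All : ∀ {f g} h → All (λ t → f (proj₂ t) ≡ g (proj₂ t)) h → eval f h ≡ eval g h
  eval-All []             []        = refl
  eval-All ((a , x) ∷ h) (e ∷ es) = cong₂ (λ u v → a * u + v) e (eval-All h es)

  eval-cong : ∀ {f g} → (∀ x → f x ≡ g x) → ∀ h → eval f h ≡ eval g h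
  eval-cong e []             = refl
  eval-cong e ((a , x) ∷ h) = cong₂ (λ u v → a * u + v) (e x) (eval-cong e h)

  eval-+ : ∀ f g h → eval (λ x → f x + g x) h ≡ eval f h + eval g h
  eval-+ f g []             = sym (ℚP.+-identityˡ _)
  eval-+ f g ((a , x) ∷ h) rewrite eval-+ f g h =
    solve 5 (λ a u v p q → a :* (u :+ v) :+ (p :+ q) := a :* u :+ p :+ (a :* v :+ q))
          refl a (f x) (g x) (eval f h) (eval g h)

  eval-* : ∀ c f h → eval (λ x → c * f x) h ≡ c * eval f h
  eval-* c f []             = sym (ℚP.*-zeroʳ c)
  eval-* c f ((a , x) ∷ h) rewrite eval-* c f h =
    solve 4 (λ c a u p → a :* (c :* u) :+ c :* p := c :* (a :* u :+ p)) refl c a (f x) (eval f h)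

  eval-0 : ∀ h → eval (λ _ → 0ℚ) h ≡ 0ℚ
  eval-0 []             = refl
  eval-0 ((a , x) ∷ h) rewrite eval-0 h = solve 1 (λ a → a :* con 0ℚ :+ con 0ℚ := con 0ℚ) refl a

  eval-scale : ∀ f c h → eval f (List.map (λ t → (c * proj₁ t , proj₂ t)) h) ≡ c * eval f h
  eval-scale f c []             = sym (ℚP.*-zeroʳ c)
  eval-scale f c ((a , x) ∷ h) rewrite eval-scale f c h =
    solve 4 (λ c a u p → c :* a :* u :+ c :* p := c :* (a :* u :+ p)) refl c a (f x) (eval f h)

  eval-filter : ∀ {P : A → Set} (P? : ∀ x → Dec (P x)) f h →
    eval f (filter (λ t → P? (proj₂ t)) h) ≡ eval (λ x → when (does (P? x)) (f x)) h
  eval-filter P? f []             = refl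
  eval-filter P? f ((a , x) ∷ h) with P? x
  ... | yes _ = cong (a * f x +_) (eval-filter P? f h)
  ... | no  _ = trans (eval-filter P? f h)
                      (sym (trans (cong (_+ _) (ℚP.*-zeroʳ a)) (ℚP.+-identityˡ _)))

  sum-coefficients : ∀ h → sumℚ (List.map proj₁ h) ≡ eval (λ _ → 1ℚ) h
  sum-coefficients []             = refl
  sum-coefficients ((a , x) ∷ h) = cong₂ _+_ (sym (ℚP.*-identityʳ a)) (sum-coefficients h)

  sum-weighted : ∀ (φ : A → ℚ) h → sumℚ (List.map (λ t → proj₁ t * φ (proj₂ t)) h) ≡ eval φ h
  sum-weighted φ []             = refl
  sum-weighted φ ((a , x) ∷ h) = cong (a * φ x +_) (sum-weighted φ h)

-- The proof
-- removes one support point at a time, by induction on the total length.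
module Extensionality {A : Set} (_≟_ : DecidableEquality A) where
  open Evaluation {A}

  -- The coordinate functional at x: eval (δ x) h is the coefficient of x in h.
  δ : A → A → ℚ
  δ x y = when (does (y ≟ x)) 1ℚ

  δ-self : ∀ x → δ x x ≡ 1ℚ
  δ-self x with x ≟ x
  ... | yes _ = refl
  ... | no x≢x = ⊥-elim (x≢x refl)

  δ-other : ∀ x y → y ≢ x → δ x y ≡ 0ℚ
  δ-other x y y≢x with y ≟ x
  ... | yes y≡x = ⊥-elim (y≢x y≡x)
  ... | no _ = refl

  SameCoefficients : List (ℚ × A) → List (ℚ × A) → Set
  SameCoefficients h g = ∀ x → eval (δ x) h ≡ eval (δ x) g

  without : A → List (ℚ × A) → List (ℚ × A)
  without x = filter (λ t → ¬? (proj₂ t ≟ x))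

  eval-split : ∀ f x h → eval f h ≡ f x * eval (δ x) h + eval f (without x h)
  eval-split f x [] = sym (trans (cong (_+ 0ℚ) (ℚP.*-zeroʳ (f x))) (ℚP.+-identityʳ 0ℚ))
  eval-split f x ((a , y) ∷ h) with y ≟ x
  ... | yes refl rewrite eval-split f x h =
    solve 4 (λ a u p q → a :* u :+ (u :* p :+ q) := u :* (a :* con 1ℚ :+ p) :+ q)
          refl a (f x) (eval (δ x) h) (eval f (without x h))
  ... | no _ rewrite eval-split f x h =
    solve 5 (λ a u v p q → a :* v :+ (u :* p :+ q) := u :* (a :* con 0ℚ :+ p) :+ (a :* v :+ q))
          refl a (f x) (f y) (eval (δ x) h) (eval f (without x h))

  coefficient-without-self : ∀ x h → eval (δ x) (without x h) ≡ 0ℚ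
  coefficient-without-self x [] = refl
  coefficient-without-self x ((a , y) ∷ h) with y ≟ x
  ... | yes _ = coefficient-without-self x h
  ... | no y≢x rewrite coefficient-without-self x h | δ-other x y y≢x =
    solve 1 (λ a → a :* con 0ℚ :+ con 0ℚ := con 0ℚ) refl a

  coefficient-without-other : ∀ z x → z ≢ x → ∀ h → eval (δ z) (without x h) ≡ eval (δ z) h
  coefficient-without-other z x z≢x [] = refl
  coefficient-without-other z x z≢x ((a , y) ∷ h) with y ≟ x
  ... | no _ = cong (a * δ z y +_) (coefficient-without-other z x z≢x h)
  ... | yes refl rewrite δ-other z x (λ x≡z → z≢x (sym x≡z)) =
    trans (coefficient-without-other z x z≢x h)
          (sym (trans (cong (_+ _) (ℚP.*-zeroʳ a)) (ℚP.+-identityˡ _)))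

  same-without : ∀ x h g → SameCoefficients h g → SameCoefficients (without x h) (without x g)
  same-without x h g same z with z ≟ x
  ... | yes refl = trans (coefficient-without-self x h) (sym (coefficient-without-self x g))
  ... | no z≢x   = trans (coefficient-without-other z x z≢x h)
                     (trans (same z) (sym (coefficient-without-other z x z≢x g)))

  extend-from-without : ∀ x h g → SameCoefficients h g →
    (∀ f → eval f (without x h) ≡ eval f (without x g)) → ∀ f → eval f h ≡ eval f g
  extend-from-without x h g same ih f =
    trans (eval-split f x h)
          (trans (cong₂ (λ u v → f x * u + v) (same x) (ih f)) (sym (eval-split f x g)))

  length-without : ∀ x h → length (without x h) ≤ length h
  length-without x = ListP.length-filter (λ t → ¬? (proj₂ t ≟ x))

  length-without-head : ∀ x a h → length (without x ((a , x) ∷ h)) ≤ length h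
  length-without-head x a h with x ≟ x
  ... | yes _ = length-without x h
  ... | no x≢x = ⊥-elim (x≢x refl)

  coefficient-ext-bounded : ∀ n h g → length h ℕ.+ length g < n →
    SameCoefficients h g → ∀ f → eval f h ≡ eval f g
  coefficient-ext-bounded (suc n) [] [] _ _ f = refl
  coefficient-ext-bounded (suc n) ((a , x) ∷ h) g (s≤s bound) same =
    extend-from-without x ((a , x) ∷ h) g same
      (coefficient-ext-bounded n (without x ((a , x) ∷ h)) (without x g)
        (ℕP.≤-<-trans (ℕP.+-mono-≤ (length-without-head x a h) (length-without x g)) bound)
        (same-without x ((a , x) ∷ h) g same))
  coefficient-ext-bounded (suc n) [] ((a , x) ∷ g) (s≤s bound) same =
    extend-from-without x [] ((a , x) ∷ g) same
      (coefficient-ext-bounded n [] (without x ((a , x) ∷ g))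
        (ℕP.≤-<-trans (length-without-head x a g) bound)
        (same-without x [] ((a , x) ∷ g) same))

  coefficient-ext : ∀ h g → SameCoefficients h g → ∀ f → eval f h ≡ eval f g
  coefficient-ext h g = coefficient-ext-bounded (suc (length h ℕ.+ length g)) h g ℕP.≤-refl

concatMap-++ : ∀ {A B : Set} (f : A → List B) xs ys →
  concatMap f (xs ++ ys) ≡ concatMap f xs ++ concatMap f ys
concatMap-++ f xs ys =
  trans (cong concat (ListP.map-++ f xs ys)) (sym (ListP.concat-++ (List.map f xs) (List.map f ys)))

module Coefficients {ℓ : ℕ} where
  open Evaluation
  open Extensionality (_≟C_ {ℓ}) using (δ; coefficient-ext)

  Bi : Set
  Bi = VComp ℓ × VComp ℓ

  _≟B_ : DecidableEquality Bi
  p ≟B q = map′ (λ e → cong₂ _,_ (proj₁ e) (proj₂ e)) (λ e → cong proj₁ e , cong proj₂ e)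
                ((proj₁ p ≟C proj₁ q) ×-dec (proj₂ p ≟C proj₂ q))

  open Extensionality _≟B_ using () renaming (δ to δ²)

  coeff-eval : ∀ (h : QSym ℓ) I → coeff h I ≡ eval (δ I) h
  coeff-eval h I = trans (sum-coefficients (filter (λ t → proj₂ t ≟C I) h))
                         (eval-filter (λ x → x ≟C I) (λ _ → 1ℚ) h)

  coeff²-eval : ∀ (t : QSym² ℓ) J K → coeff² t J K ≡ eval (δ² (J , K)) t
  coeff²-eval t J K =
    trans (sum-coefficients (filter (λ s → (proj₁ (proj₂ s) ≟C J) ×-dec (proj₂ (proj₂ s) ≟C K)) t))
          (eval-filter (λ x → (proj₁ x ≟C J) ×-dec (proj₂ x ≟C K)) (λ _ → 1ℚ) t)

  ≃⇒eval : ∀ (h g : QSym ℓ) → h ≃ g → ∀ f → eval f h ≡ eval f g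
  ≃⇒eval h g h≃g =
    coefficient-ext h g λ I → trans (sym (coeff-eval h I)) (trans (h≃g I) (coeff-eval g I))

  eval⇒≃ : ∀ (h g : QSym ℓ) → (∀ f → eval f h ≡ eval f g) → h ≃ g
  eval⇒≃ h g e I = trans (coeff-eval h I) (trans (e (δ I)) (sym (coeff-eval g I)))

  eval⇒≃² : ∀ (t u : QSym² ℓ) → (∀ f → eval f t ≡ eval f u) → t ≃² u
  eval⇒≃² t u e J K = trans (coeff²-eval t J K) (trans (e (δ² (J , K))) (sym (coeff²-eval u J K)))

  coeff-++ : ∀ (h g : QSym ℓ) I → coeff (h ++ g) I ≡ coeff h I + coeff g I
  coeff-++ h g I = trans (coeff-eval (h ++ g) I)
    (trans (eval-++ (δ I) h g) (sym (cong₂ _+_ (coeff-eval h I) (coeff-eval g I))))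

  coeff-scale : ∀ a (h : QSym ℓ) I → coeff (scale a h) I ≡ a * coeff h I
  coeff-scale a h I = trans (coeff-eval (scale a h) I)
    (trans (eval-scale (δ I) a h) (cong (a *_) (sym (coeff-eval h I))))

  coeff-filter : ∀ {P : VComp ℓ → Set} (P? : ∀ x → Dec (P x)) (h : QSym ℓ) I →
    coeff (filter (λ t → P? (proj₂ t)) h) I ≡ when (does (P? I)) 1ℚ * coeff h I
  coeff-filter P? h I =
    trans (coeff-eval (filter (λ t → P? (proj₂ t)) h) I)
    (trans (eval-filter P? (δ I) h)
    (trans (eval-cong restrict-δ h)
    (trans (eval-* (when (does (P? I)) 1ℚ) (δ I) h)
           (cong (when (does (P? I)) 1ℚ *_) (sym (coeff-eval h I))))))
    where
      restrict-δ : ∀ x → when (does (P? x)) (δ I x) ≡ when (does (P? I)) 1ℚ * δ I x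
      restrict-δ x with x ≟C I
      ... | yes refl = sym (ℚP.*-identityʳ _)
      ... | no _ = trans (when-0 (does (P? x))) (sym (ℚP.*-zeroʳ (when (does (P? I)) 1ℚ)))

  degree? : (n : Vec ℕ ℓ) (I : VComp ℓ) → Dec (deg I ≡ n)
  degree? n I = VecP.≡-dec ℕ._≟_ (deg I) n

  filtered-nonzero : ∀ {P : VComp ℓ → Set} (P? : ∀ x → Dec (P x)) (h : QSym ℓ) I →
    coeff (filter (λ t → P? (proj₂ t)) h) I ≢ 0ℚ → P I × coeff h I ≢ 0ℚ
  filtered-nonzero P? h I c≢0 with P? I | coeff-filter P? h I
  ... | yes p | eq = p , λ c≡0 → c≢0 (trans eq (trans (ℚP.*-identityˡ _) c≡0))
  ... | no _  | eq = ⊥-elim (c≢0 (trans eq (ℚP.*-zeroˡ (coeff h I))))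

  -- The terms of h whose composition has a nonzero coefficient in h; it
  -- represents the same element and every composition in it really occurs.
  support : QSym ℓ → QSym ℓ
  support h = filter (λ t → ¬? (coeff h (proj₂ t) ℚP.≟ 0ℚ)) h

  support-≃ : ∀ h → h ≃ support h
  support-≃ h I = trans (keep-nonzero (coeff h I ℚP.≟ 0ℚ))
    (sym (coeff-filter (λ x → ¬? (coeff h x ℚP.≟ 0ℚ)) h I))
    where
      keep-nonzero : ∀ {c} (c≟0 : Dec (c ≡ 0ℚ)) → c ≡ when (does (¬? c≟0)) 1ℚ * c
      keep-nonzero {c} (yes c≡0) = trans c≡0 (sym (ℚP.*-zeroˡ c))
      keep-nonzero     (no _)    = sym (ℚP.*-identityˡ _)

  support-occurs : ∀ h → All (λ t → coeff h (proj₂ t) ≢ 0ℚ) (support h)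
  support-occurs h = AllP.all-filter (λ t → ¬? (coeff h (proj₂ t) ℚP.≟ 0ℚ)) h

  coeff²-++ : ∀ (t u : QSym² ℓ) J K → coeff² (t ++ u) J K ≡ coeff² t J K + coeff² u J K
  coeff²-++ t u J K = trans (coeff²-eval (t ++ u) J K)
    (trans (eval-++ (δ² (J , K)) t u) (sym (cong₂ _+_ (coeff²-eval t J K) (coeff²-eval u J K))))

  row : ℚ → VComp ℓ → QSym ℓ → QSym² ℓ
  row a X = List.map (λ t → (a * proj₁ t , X , proj₂ t))

  coeff²-row-match : ∀ a X d K → coeff² (row a X d) X K ≡ a * coeff d K
  coeff²-row-match a X [] K = sym (ℚP.*-zeroʳ a)
  coeff²-row-match a X ((b , Y) ∷ d) K with X ≟C X | Y ≟C K
  ... | no X≢X | _    = ⊥-elim (X≢X refl)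
  ... | yes _ | no _  = coeff²-row-match a X d K
  ... | yes _ | yes _ =
    trans (cong (a * b +_) (coeff²-row-match a X d K)) (sym (ℚP.*-distribˡ-+ a b _))

  coeff²-row-mismatch : ∀ a X d J K → X ≢ J → coeff² (row a X d) J K ≡ 0ℚ
  coeff²-row-mismatch a X [] J K _ = refl
  coeff²-row-mismatch a X ((b , Y) ∷ d) J K X≢J with X ≟C J
  ... | yes X≡J = ⊥-elim (X≢J X≡J)
  ... | no _    = coeff²-row-mismatch a X d J K X≢J

  coeff²-⊗ : ∀ (c d : QSym ℓ) J K → coeff² (c ⊗ d) J K ≡ coeff c J * coeff d K
  coeff²-⊗ [] d J K = sym (ℚP.*-zeroˡ (coeff d K))
  coeff²-⊗ ((a , X) ∷ c) d J K with X ≟C J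
  ... | yes refl =
    trans (coeff²-++ (row a X d) (c ⊗ d) X K)
          (trans (cong₂ _+_ (coeff²-row-match a X d K) (coeff²-⊗ c d X K))
                 (sym (ℚP.*-distribʳ-+ (coeff d K) a (coeff c X))))
  ... | no X≢J =
    trans (coeff²-++ (row a X d) (c ⊗ d) J K)
          (trans (cong₂ _+_ (coeff²-row-mismatch a X d J K X≢J) (coeff²-⊗ c d J K))
                 (ℚP.+-identityˡ _))

Σ< : ℕ → (ℕ → ℚ) → ℚ
Σ< zero    φ = 0ℚ
Σ< (suc n) φ = φ 0 + Σ< n (λ j → φ (suc j))

Σ<-0 : ∀ n → Σ< n (λ _ → 0ℚ) ≡ 0ℚ
Σ<-0 zero    = refl
Σ<-0 (suc n) = trans (ℚP.+-identityˡ _) (Σ<-0 n)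

sum-applyUpTo : ∀ {B : Set} n (f : ℕ → B) (φ : B → ℚ) →
  sumℚ (List.map φ (List.applyUpTo f n)) ≡ Σ< n (λ j → φ (f j))
sum-applyUpTo zero    f φ = refl
sum-applyUpTo (suc n) f φ = cong (φ (f 0) +_) (sum-applyUpTo n (λ j → f (suc j)) φ)

module Coproduct {ℓ : ℕ} where
  open Evaluation
  open Coefficients {ℓ}
  open Extensionality (_≟C_ {ℓ}) using (δ)
  open Extensionality _≟B_ using () renaming (δ to δ²)

  cuts : (Bi → ℚ) → VComp ℓ → ℚ
  cuts F I = Σ< (suc (length I)) (λ j → F (take j I , drop j I))

  eval-Δ : ∀ F h → eval F (Δ h) ≡ eval (cuts F) h
  eval-Δ F [] = refl
  eval-Δ F ((a , I) ∷ h) =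
    trans (eval-++ F (List.map (λ j → (a , take j I , drop j I)) (upTo (suc (length I)))) (Δ h))
          (cong₂ _+_ (trans (eval-term-of (upTo (suc (length I))))
                            (cong (a *_) (sum-applyUpTo (suc (length I)) (λ j → j) cut-value)))
                     (eval-Δ F h))
    where
      cut-value : ℕ → ℚ
      cut-value j = F (take j I , drop j I)

      eval-term-of : ∀ js → eval F (List.map (λ j → (a , take j I , drop j I)) js)
                            ≡ a * sumℚ (List.map (λ j → F (take j I , drop j I)) js)
      eval-term-of []       = sym (ℚP.*-zeroʳ a)
      eval-term-of (j ∷ js) = trans (cong (a * F (take j I , drop j I) +_) (eval-term-of js))
                                    (sym (ℚP.*-distribˡ-+ a _ _))

  guarded-Σ< : ∀ b n (c d : ℕ → Bool) e → Σ< n (λ j → when (c j ∧ d j) 1ℚ) ≡ when e 1ℚ →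
    Σ< n (λ j → when ((b ∧ c j) ∧ d j) 1ℚ) ≡ when (b ∧ e) 1ℚ
  guarded-Σ< true  n c d e eq = eq
  guarded-Σ< false n c d e eq = Σ<-0 n

  -- Unique factorisation: exactly one cut of I yields (J , K) if I = JK, none otherwise.
  cuts-δ : ∀ J K I → cuts (δ² (J , K)) I ≡ δ (J ++ K) I
  cuts-δ []      K []      = ℚP.+-identityʳ _
  cuts-δ (y ∷ J) K []      = refl
  cuts-δ []      K (x ∷ I) =
    trans (cong (when (does ((x ∷ I) ≟C K)) 1ℚ +_) (Σ<-0 (suc (length I)))) (ℚP.+-identityʳ _)
  cuts-δ (y ∷ J) K (x ∷ I) =
    trans (ℚP.+-identityˡ _)
          (guarded-Σ< (does (x ≟L y)) (suc (length I)) (λ j → does (take j I ≟C J))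
                      (λ j → does (drop j I ≟C K)) (does (I ≟C (J ++ K))) (cuts-δ J K I))

  coeff-Δ : ∀ (h : QSym ℓ) J K → coeff² (Δ h) J K ≡ coeff h (J ++ K)
  coeff-Δ h J K = trans (coeff²-eval (Δ h) J K)
    (trans (eval-Δ (δ² (J , K)) h) (trans (eval-cong (cuts-δ J K) h) (sym (coeff-eval h (J ++ K)))))

  Δ-cong : ∀ (h g : QSym ℓ) → h ≃ g → Δ h ≃² Δ g
  Δ-cong h g h≃g = eval⇒≃² (Δ h) (Δ g) λ F →
    trans (eval-Δ F h) (trans (≃⇒eval h g h≃g (cuts F)) (sym (eval-Δ F g)))

  tensors : List (QSym ℓ × QSym ℓ) → QSym² ℓ
  tensors = concatMap (λ p → proj₁ p ⊗ proj₂ p)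

  cutPair : ℚ → VComp ℓ → ℕ → QSym ℓ × QSym ℓ
  cutPair a I j = ((a , take j I) ∷ [] , (1ℚ , drop j I) ∷ [])

  cutPairs : QSym ℓ → List (QSym ℓ × QSym ℓ)
  cutPairs [] = []
  cutPairs ((a , I) ∷ h) = List.map (cutPair a I) (upTo (suc (length I))) ++ cutPairs h

  cutPairs-Δ : ∀ h → tensors (cutPairs h) ≡ Δ h
  cutPairs-Δ [] = refl
  cutPairs-Δ ((a , I) ∷ h) =
    trans (concatMap-++ (λ p → proj₁ p ⊗ proj₂ p) (List.map (cutPair a I) (upTo (suc (length I)))) (cutPairs h))
          (cong₂ _++_ (cuts-of (upTo (suc (length I)))) (cutPairs-Δ h))
    where
      cuts-of : ∀ js → tensors (List.map (cutPair a I) js)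
                       ≡ List.map (λ j → (a , take j I , drop j I)) js
      cuts-of []       = refl
      cuts-of (j ∷ js) =
        cong₂ _∷_ (cong (λ c → (c , take j I , drop j I)) (ℚP.*-identityʳ a)) (cuts-of js)

neg-neg : ∀ q → - (- q) ≡ q
neg-neg = solve 1 (λ q → :- (:- q) := q) refl

two-more : ∀ m → (2 ℕ.+ m) % 2 ≡ m % 2
two-more m = trans (cong (_% 2) (ℕP.+-comm 2 m)) (ℕDM.[m+n]%n≡m%n m 2)

parity : ∀ m → (Even m × negOnePow m ≡ 1ℚ) ⊎ (Odd m × negOnePow m ≡ - 1ℚ)
parity zero          = inj₁ (refl , refl)
parity (suc zero)    = inj₂ (refl , refl)
parity (suc (suc m)) with parity m
... | inj₁ (even , p) = inj₁ (trans (two-more m) even , trans (neg-neg (negOnePow m)) p)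
... | inj₂ (odd , p)  = inj₂ (trans (two-more m) odd , trans (neg-neg (negOnePow m)) p)

even⇒sign : ∀ m → Even m → negOnePow m ≡ 1ℚ
even⇒sign m e with parity m
... | inj₁ (_ , p) = p
... | inj₂ (o , _) with trans (sym e) o
... | ()

odd⇒sign : ∀ m → Odd m → negOnePow m ≡ - 1ℚ
odd⇒sign m o with parity m
... | inj₂ (_ , p) = p
... | inj₁ (e , _) with trans (sym e) o
... | ()

odd⇒nonzero : ∀ {ℓ} (n : Vec ℕ ℓ) → Odd ∣ n ∣ᵛ → T (isNZ n)
odd⇒nonzero []          ()
odd⇒nonzero (zero  ∷ n) o = odd⇒nonzero n o
odd⇒nonzero (suc _ ∷ n) o = tt

-- An element of the ideal generated by G is a
-- sum of sandwiches a · g · b with g ∈ G; since a sandwich depends linearly on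
-- its middle factor, the generators ζ̄_n − ζ_n = ((-1)^|n| − 1) S_n of 𝓘𝓔^k
-- vanish for |n| even and are −2 S_n for |n| odd.
module Ideals {ℓ : ℕ} where
  open Evaluation
  open Coefficients {ℓ}

  Sandwich : Set
  Sandwich = NSym ℓ × NSym ℓ × NSym ℓ

  middle : Sandwich → NSym ℓ
  middle t = proj₁ (proj₂ t)

  sandwich : Sandwich → NSym ℓ
  sandwich t = (proj₁ t · middle t) · proj₂ (proj₂ t)

  sandwiches : List Sandwich → NSym ℓ
  sandwiches = concatMap sandwich

  eval-· : ∀ f (a g : NSym ℓ) → eval f (a · g) ≡ eval (λ I → eval (λ J → f (I ++ J)) g) a
  eval-· f [] g = refl
  eval-· f ((c , I) ∷ a) g =
    trans (eval-++ f (List.map (λ t → (c * proj₁ t , I ++ proj₂ t)) g) (a · g))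
          (cong₂ _+_ (left-term g) (eval-· f a g))
    where
      left-term : ∀ g → eval f (List.map (λ t → (c * proj₁ t , I ++ proj₂ t)) g)
                        ≡ c * eval (λ J → f (I ++ J)) g
      left-term [] = sym (ℚP.*-zeroʳ c)
      left-term ((b , J) ∷ g) rewrite left-term g =
        solve 4 (λ c b u p → c :* b :* u :+ c :* p := c :* (b :* u :+ p))
              refl c b (f (I ++ J)) (eval (λ J → f (I ++ J)) g)

  eval-swap : ∀ (F : VComp ℓ → VComp ℓ → ℚ) (a g : NSym ℓ) →
    eval (λ x → eval (F x) g) a ≡ eval (λ y → eval (λ x → F x y) a) g
  eval-swap F [] g = sym (eval-0 g)
  eval-swap F ((c , x) ∷ a) g =
    trans (cong₂ _+_ (sym (eval-* c (F x) g)) (eval-swap F a g))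
          (sym (eval-+ (λ y → c * F x y) (λ y → eval (λ x' → F x' y) a) g))

  through : NSym ℓ → NSym ℓ → (VComp ℓ → ℚ) → VComp ℓ → ℚ
  through a b f J = eval (λ I → eval (λ K → f ((I ++ J) ++ K)) b) a

  eval-sandwich : ∀ f (a g b : NSym ℓ) → eval f ((a · g) · b) ≡ eval (through a b f) g
  eval-sandwich f a g b =
    trans (eval-· f (a · g) b)
          (trans (eval-· (λ I → eval (λ K → f (I ++ K)) b) a g)
                 (eval-swap (λ I J → eval (λ K → f ((I ++ J) ++ K)) b) a g))

  eval-sandwich-scale : ∀ f c (a g b : NSym ℓ) →
    eval f ((scale c a · g) · b) ≡ c * eval f ((a · g) · b)
  eval-sandwich-scale f c a g b =
    trans (eval-sandwich f (scale c a) g b)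
          (trans (eval-cong (λ J → eval-scale _ c a) g)
          (trans (eval-* c (through a b f) g) (cong (c *_) (sym (eval-sandwich f a g b)))))

  generator : Vec ℕ ℓ → NSym ℓ
  generator n = ζ̄N n −N ζN n

  eval-sandwich-generator : ∀ f (a b : NSym ℓ) n →
    eval f ((a · generator n) · b) ≡ (negOnePow ∣ n ∣ᵛ + - 1ℚ) * eval f ((a · S n) · b)
  eval-sandwich-generator f a b n = begin
    eval f ((a · generator n) · b)
      ≡⟨ eval-sandwich f a (generator n) b ⟩
    eval φ (scale σ (S n) ++ scale (- 1ℚ) (S n))
      ≡⟨ eval-++ φ (scale σ (S n)) (scale (- 1ℚ) (S n)) ⟩
    eval φ (scale σ (S n)) + eval φ (scale (- 1ℚ) (S n))
      ≡⟨ cong₂ _+_ (eval-scale φ σ (S n)) (eval-scale φ (- 1ℚ) (S n)) ⟩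
    σ * eval φ (S n) + - 1ℚ * eval φ (S n)
      ≡⟨ sym (ℚP.*-distribʳ-+ (eval φ (S n)) σ (- 1ℚ)) ⟩
    (σ + - 1ℚ) * eval φ (S n)
      ≡⟨ cong ((σ + - 1ℚ) *_) (sym (eval-sandwich f a (S n) b)) ⟩
    (σ + - 1ℚ) * eval f ((a · S n) · b) ∎
    where
      open ≡-Reasoning
      σ = negOnePow ∣ n ∣ᵛ
      φ = through a b f

  generator-even : ∀ n → Even ∣ n ∣ᵛ → ∀ f a b → eval f ((a · generator n) · b) ≡ 0ℚ
  generator-even n even f a b =
    trans (eval-sandwich-generator f a b n)
    (trans (cong (λ s → (s + - 1ℚ) * eval f ((a · S n) · b)) (even⇒sign ∣ n ∣ᵛ even))
           (ℚP.*-zeroˡ (eval f ((a · S n) · b))))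

  generator-odd : ∀ n → Odd ∣ n ∣ᵛ → ∀ f a b →
    eval f ((a · generator n) · b) ≡ eval f ((scale (- 1ℚ + - 1ℚ) a · S n) · b)
  generator-odd n odd f a b =
    trans (eval-sandwich-generator f a b n)
    (trans (cong (λ s → (s + - 1ℚ) * eval f ((a · S n) · b)) (odd⇒sign ∣ n ∣ᵛ odd))
           (sym (eval-sandwich-scale f (- 1ℚ + - 1ℚ) a (S n) b)))

  eval-sandwiches-++ : ∀ f ts us →
    eval f (sandwiches (ts ++ us)) ≡ eval f (sandwiches ts) + eval f (sandwiches us)
  eval-sandwiches-++ f ts us =
    trans (cong (eval f) (concatMap-++ sandwich ts us)) (eval-++ f (sandwiches ts) (sandwiches us))

  eval-sandwiches-single : ∀ f t → eval f (sandwiches (t ∷ [])) ≡ eval f (sandwich t)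
  eval-sandwiches-single f t = trans (eval-++ f (sandwich t) []) (ℚP.+-identityʳ _)

  Expressible : (NSym ℓ → Set) → (NSym ℓ → Set) → Set
  Expressible G G' = ∀ t → G (middle t) →
    Σ (List Sandwich) λ us → All (λ u → G' (middle u)) us
                             × (∀ f → eval f (sandwich t) ≡ eval f (sandwiches us))

  ideal-⊆ : ∀ G G' → Expressible G G' → ∀ x → InIdeal G x → InIdeal G' x
  ideal-⊆ G G' express x (ts , inG , x≃) =
    let (us , inG' , same) = rewrite-all ts inG
    in us , inG' , eval⇒≃ x (sandwiches us) (λ f → trans (≃⇒eval x (sandwiches ts) x≃ f) (same f))
    where
      rewrite-all : ∀ ts → All (λ t → G (middle t)) ts →
        Σ (List Sandwich) λ us → All (λ u → G' (middle u)) us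
                                 × (∀ f → eval f (sandwiches ts) ≡ eval f (sandwiches us))
      rewrite-all [] [] = [] , [] , λ f → refl
      rewrite-all (t ∷ ts) (Gt ∷ inG) =
        let (us₁ , inG₁ , same₁) = express t Gt
            (us₂ , inG₂ , same₂) = rewrite-all ts inG
        in us₁ ++ us₂ , AllP.++⁺ inG₁ inG₂ , λ f →
             trans (eval-++ f (sandwich t) (sandwiches ts))
                   (trans (cong₂ _+_ (same₁ f) (same₂ f)) (sym (eval-sandwiches-++ f us₁ us₂)))

  generators-via-odd : ∀ k → Expressible (GenIE k) (GenOdd k)
  generators-via-odd k (a , _ , b) (n , n≤k , refl) with parity ∣ n ∣ᵛ
  ... | inj₁ (even , _) = [] , [] , λ f → generator-even n even f a b
  ... | inj₂ (odd , _)  =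
    (scale (- 1ℚ + - 1ℚ) a , S n , b) ∷ [] , (n , odd⇒nonzero n odd , n≤k , odd , refl) ∷ [] , λ f →
    trans (generator-odd n odd f a b) (sym (eval-sandwiches-single f (scale (- 1ℚ + - 1ℚ) a , S n , b)))

  -- S_n = −½ (ζ̄_n − ζ_n) for |n| odd.
  odd-via-generators : ∀ k → Expressible (GenOdd k) (GenIE k)
  odd-via-generators k (a , _ , b) (n , _ , n≤k , odd , refl) =
    (scale (- ½) a , generator n , b) ∷ [] , (n , n≤k , refl) ∷ [] , λ f →
    sym (trans (eval-sandwiches-single f (scale (- ½) a , generator n , b))
        (trans (eval-sandwich-scale f (- ½) a (generator n) b)
        (trans (cong (- ½ *_) (trans (generator-odd n odd f a b)
                                     (eval-sandwich-scale f (- 1ℚ + - 1ℚ) a (S n) b)))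
               (halve-minus-two (eval f ((a · S n) · b))))))
    where
      halve-minus-two : ∀ x → - ½ * ((- 1ℚ + - 1ℚ) * x) ≡ x
      halve-minus-two = solve 1 (λ x → con (- ½) :* ((:- con 1ℚ :+ :- con 1ℚ) :* x) := x) refl

  ideal-generators : ∀ k (x : NSym ℓ) →
    (InIdeal (GenIE k) x → InIdeal (GenOdd k) x) × (InIdeal (GenOdd k) x → InIdeal (GenIE k) x)
  ideal-generators k x = ideal-⊆ (GenIE k) (GenOdd k) (generators-via-odd k) x
                       , ideal-⊆ (GenOdd k) (GenIE k) (odd-via-generators k) x

module Zeta {ℓ : ℕ} where
  open Evaluation

  ζ̄M : VComp ℓ → ℚ
  ζ̄M I = negOnePow ∣ deg I ∣ᵛ * ζM I

  ζQ-eval : ∀ (h : QSym ℓ) → ζQ h ≡ eval ζM h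
  ζQ-eval = sum-weighted ζM

  ζ̄Q-eval : ∀ (h : QSym ℓ) → ζ̄Q h ≡ eval ζ̄M h
  ζ̄Q-eval = sum-weighted ζ̄M

  size-zero : ∀ m → ∣ Vec.replicate m 0 ∣ᵛ ≡ 0
  size-zero zero    = refl
  size-zero (suc m) = size-zero m

  zero-is-zero : ∀ m → isNZ (Vec.replicate m 0) ≡ false
  zero-is-zero zero    = refl
  zero-is-zero (suc m) = zero-is-zero m

  deg-letter : (i : Letter ℓ) → deg (i ∷ []) ≡ proj₁ i
  deg-letter i = plus-zero (proj₁ i)
    where plus-zero : ∀ {m} (v : Vec ℕ m) → Vec.zipWith ℕ._+_ v (Vec.replicate m 0) ≡ v
          plus-zero []      = refl
          plus-zero (x ∷ v) = cong₂ _∷_ (ℕP.+-identityʳ x) (plus-zero v)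

-- Membership only constrains the compositions that occur,
-- so everything is checked on the support, where all compositions are good.
module EvenSpanAdmissible {ℓ : ℕ} (k : Vec ℕ∞ ℓ) where
  open Evaluation
  open Coefficients {ℓ}
  open Coproduct {ℓ}
  open Zeta {ℓ}

  -- A coefficient of a sum or multiple is nonzero only if one of the parts' is.
  subspace : IsSubspace (EvenSpan k)
  subspace = (λ h g h≃g inh I c≢0 → inh I (λ c≡0 → c≢0 (trans (sym (h≃g I)) c≡0)))
           , (λ I c≢0 → ⊥-elim (c≢0 refl))
           , (λ h g inh ing I c≢0 → in-++ h g inh ing I c≢0 (coeff h I ℚP.≟ 0ℚ))
           , (λ a h inh I c≢0 → inh I λ c≡0 →
                c≢0 (trans (coeff-scale a h I) (trans (cong (a *_) c≡0) (ℚP.*-zeroʳ a))))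
    where
      in-++ : ∀ h g → EvenSpan k h → EvenSpan k g → ∀ I → coeff (h ++ g) I ≢ 0ℚ →
              Dec (coeff h I ≡ 0ℚ) → GoodComp k I
      in-++ h g inh ing I c≢0 (no ch≢0)  = inh I ch≢0
      in-++ h g inh ing I c≢0 (yes ch≡0) = ing I λ cg≡0 →
        c≢0 (trans (coeff-++ h g I) (trans (cong₂ _+_ ch≡0 cg≡0) (ℚP.+-identityʳ 0ℚ)))

  -- A component only keeps terms of h.
  graded : IsGraded (EvenSpan k)
  graded n h inh I c≢0 = inh I (proj₂ (filtered-nonzero (degree? n) h I c≢0))

  support-good : ∀ h → EvenSpan k h → All (λ t → GoodComp k (proj₂ t)) (support h)
  support-good h inh = All.map (λ {t} → inh (proj₂ t)) (support-occurs h)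

  term-in-span : ∀ a X → GoodComp k X → EvenSpan k ((a , X) ∷ [])
  term-in-span a X good I c≢0 with X ≟C I
  ... | yes refl = good
  ... | no _     = ⊥-elim (c≢0 refl)

  -- Prefixes and suffixes of good compositions are good, so
  -- Δ of a sum of good terms is a sum of tensors of good terms.
  cutPairs-in-span : ∀ h → All (λ t → GoodComp k (proj₂ t)) h →
    All (λ p → EvenSpan k (proj₁ p) × EvenSpan k (proj₂ p)) (cutPairs h)
  cutPairs-in-span [] [] = []
  cutPairs-in-span ((a , I) ∷ h) (good ∷ goods) =
    AllP.++⁺ (AllP.map⁺ (All.universal
               (λ j → term-in-span a (take j I) (AllP.take⁺ j good)
                    , term-in-span 1ℚ (drop j I) (AllP.drop⁺ j good))
               (upTo (suc (length I)))))
             (cutPairs-in-span h goods)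

  -- Δ h = Δ (support h) is a sum of tensors of good terms.
  subcoalgebra : IsSubcoalgebra (EvenSpan k)
  subcoalgebra h inh =
    cutPairs (support h) , cutPairs-in-span (support h) (support-good h inh) ,
    subst (Δ h ≃²_) (sym (cutPairs-Δ (support h))) (Δ-cong h (support h) (support-≃ h))

  homogeneous-degree : ∀ n h → Homogeneous n h → ∀ I → coeff h I ≢ 0ℚ → deg I ≡ n
  homogeneous-degree n h hom I c≢0 =
    proj₁ (filtered-nonzero (degree? n) h I λ c≡0 → c≢0 (trans (hom I) c≡0))

  -- On a good composition of degree ≤ k, ζ̄ and ζ agree: ζ vanishes off
  -- compositions of length ≤ 1, and a single letter ≤ k has even size.
  ζ-agree : ∀ I → deg I ≤ᵛ k → GoodComp k I → ζ̄M I ≡ ζM I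
  ζ-agree []           _     _           = cong (λ m → negOnePow m * 1ℚ) (size-zero ℓ)
  ζ-agree (i ∷ [])     deg≤k (good ∷ []) =
    trans (cong (λ v → negOnePow ∣ v ∣ᵛ * 1ℚ) (deg-letter i))
          (cong (_* 1ℚ) (even⇒sign ∣ proj₁ i ∣ᵛ (good (subst (_≤ᵛ k) (deg-letter i) deg≤k))))
  ζ-agree (i ∷ j ∷ I) _     _           = ℚP.*-zeroʳ (negOnePow ∣ deg (i ∷ j ∷ I) ∣ᵛ)

  zeta-even : ZetaEven k (EvenSpan k)
  zeta-even n h n≤k hom inh =
    trans (ζ̄Q-eval h)
    (trans (≃⇒eval h (support h) (support-≃ h) ζ̄M)
    (trans (eval-All (support h) agree-on-support)
    (trans (sym (≃⇒eval h (support h) (support-≃ h) ζM))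
           (sym (ζQ-eval h)))))
    where
      agree-at : ∀ I → coeff h I ≢ 0ℚ → ζ̄M I ≡ ζM I
      agree-at I c≢0 = ζ-agree I (subst (_≤ᵛ k) (sym (homogeneous-degree n h hom I c≢0)) n≤k) (inh I c≢0)

      agree-on-support : All (λ t → ζ̄M (proj₂ t) ≡ ζM (proj₂ t)) (support h)
      agree-on-support = All.map (λ {t} → agree-at (proj₂ t)) (support-occurs h)

  admissible : Admissible k (EvenSpan k)
  admissible = subspace , graded , subcoalgebra , zeta-even

-- Slicing a tensor Σ_p p₁ ⊗ p₂ by the coefficient functional of M_J on the
-- left (or M_K on the right); applied to Δ h it extracts the coefficients of h
-- at compositions beginning with J (ending with K).
module Slices {ℓ : ℕ} where
  open Coefficients {ℓ}
  open Coproduct {ℓ}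

  leftSlice : VComp ℓ → List (QSym ℓ × QSym ℓ) → QSym ℓ
  leftSlice J = concatMap (λ p → scale (coeff (proj₁ p) J) (proj₂ p))

  rightSlice : VComp ℓ → List (QSym ℓ × QSym ℓ) → QSym ℓ
  rightSlice K = concatMap (λ p → scale (coeff (proj₂ p) K) (proj₁ p))

  coeff-leftSlice : ∀ J ps K → coeff (leftSlice J ps) K ≡ coeff² (tensors ps) J K
  coeff-leftSlice J [] K = refl
  coeff-leftSlice J ((c , d) ∷ ps) K =
    trans (coeff-++ (scale (coeff c J) d) (leftSlice J ps) K)
    (trans (cong₂ _+_ (trans (coeff-scale (coeff c J) d K) (sym (coeff²-⊗ c d J K)))
                      (coeff-leftSlice J ps K))
           (sym (coeff²-++ (c ⊗ d) (tensors ps) J K)))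

  coeff-rightSlice : ∀ K ps J → coeff (rightSlice K ps) J ≡ coeff² (tensors ps) J K
  coeff-rightSlice K [] J = refl
  coeff-rightSlice K ((c , d) ∷ ps) J =
    trans (coeff-++ (scale (coeff d K) c) (rightSlice K ps) J)
    (trans (cong₂ _+_ (trans (coeff-scale (coeff d K) c J)
                             (trans (ℚP.*-comm (coeff d K) (coeff c J)) (sym (coeff²-⊗ c d J K))))
                      (coeff-rightSlice K ps J))
           (sym (coeff²-++ (c ⊗ d) (tensors ps) J K)))

  leftSlice-Δ : ∀ h ps → Δ h ≃² tensors ps → ∀ J K → coeff (leftSlice J ps) K ≡ coeff h (J ++ K)
  leftSlice-Δ h ps Δh≃ J K = trans (coeff-leftSlice J ps K) (trans (sym (Δh≃ J K)) (coeff-Δ h J K))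

  rightSlice-Δ : ∀ h ps → Δ h ≃² tensors ps → ∀ J K → coeff (rightSlice K ps) J ≡ coeff h (J ++ K)
  rightSlice-Δ h ps Δh≃ J K = trans (coeff-rightSlice K ps J) (trans (sym (Δh≃ J K)) (coeff-Δ h J K))

module Components {ℓ : ℕ} where
  open Evaluation
  open Coefficients {ℓ}
  open Extensionality (_≟C_ {ℓ}) using (δ; δ-self; δ-other)
  open Zeta {ℓ}

  -- The degree-n component is homogeneous: filtering twice is filtering once.
  component-homogeneous : ∀ n h → Homogeneous n (component n h)
  component-homogeneous n h I =
    trans (coeff-filter (degree? n) h I)
    (trans (idempotent (does (degree? n I)) (coeff h I))
           (sym (trans (coeff-filter (degree? n) (component n h) I)
                       (cong (when (does (degree? n I)) 1ℚ *_) (coeff-filter (degree? n) h I)))))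
    where
      idempotent : ∀ b c → when b 1ℚ * c ≡ when b 1ℚ * (when b 1ℚ * c)
      idempotent true  c = cong (1ℚ *_) (sym (ℚP.*-identityˡ c))
      idempotent false c = trans (ℚP.*-zeroˡ c) (sym (ℚP.*-zeroˡ (0ℚ * c)))

  ζ̄-component : ∀ n h → ζ̄Q (component n h) ≡ negOnePow ∣ n ∣ᵛ * ζQ (component n h)
  ζ̄-component n h =
    trans (ζ̄Q-eval (component n h))
    (trans (eval-filter (degree? n) ζ̄M h)
    (trans (eval-cong sign-on-degree h)
    (trans (eval-* (negOnePow ∣ n ∣ᵛ) (λ x → when (does (degree? n x)) (ζM x)) h)
           (cong (negOnePow ∣ n ∣ᵛ *_)
                 (sym (trans (ζQ-eval (component n h)) (eval-filter (degree? n) ζM h)))))))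
    where
      sign-on-degree : ∀ x → when (does (degree? n x)) (ζ̄M x)
                             ≡ negOnePow ∣ n ∣ᵛ * when (does (degree? n x)) (ζM x)
      sign-on-degree x with degree? n x
      ... | yes refl = refl
      ... | no _     = sym (ℚP.*-zeroʳ (negOnePow ∣ n ∣ᵛ))

  letter-ext : ∀ (j i : Letter ℓ) → proj₁ j ≡ proj₁ i → j ≡ i
  letter-ext (u , p) (.u , q) refl = cong (u ,_) (T-irr p q)

  ζ-letter-component : ∀ (i : Letter ℓ) h → ζQ (component (proj₁ i) h) ≡ coeff h (i ∷ [])
  ζ-letter-component i h =
    trans (ζQ-eval (component (proj₁ i) h))
    (trans (eval-filter (degree? (proj₁ i)) ζM h)
    (trans (eval-cong only-letter h) (sym (coeff-eval h (i ∷ [])))))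
    where
      only-letter : ∀ x → when (does (degree? (proj₁ i) x)) (ζM x) ≡ δ (i ∷ []) x
      only-letter [] with degree? (proj₁ i) []
      ... | yes 0≡i = ⊥-elim (subst T (trans (cong isNZ (sym 0≡i)) (zero-is-zero ℓ)) (proj₂ i))
      ... | no _    = refl
      only-letter (j ∷ []) with degree? (proj₁ i) (j ∷ [])
      ... | yes j≡i rewrite letter-ext j i (trans (sym (deg-letter j)) j≡i) = sym (δ-self (i ∷ []))
      ... | no j≢i  = sym (δ-other (i ∷ []) (j ∷ []) (λ e → j≢i (trans (cong deg e) (deg-letter i))))
      only-letter (a ∷ b ∷ r) with degree? (proj₁ i) (a ∷ b ∷ r)
      ... | yes _ = sym (δ-other (i ∷ []) (a ∷ b ∷ r) (λ ()))
      ... | no _  = sym (δ-other (i ∷ []) (a ∷ b ∷ r) (λ ()))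

-- Slicing an element h ∈ C on both sides
-- (possible because C is a subcoalgebra) gives g ∈ C whose coefficient at the
-- one-letter composition (i) is that of M_{P i Q} in h.  If i ≤ k has odd size,
-- the degree-i component of g satisfies ζ̄ = −ζ and ζ̄ = ζ, and ζ of it is that
-- coefficient, which therefore vanishes.
module Maximality {ℓ : ℕ} (k : Vec ℕ∞ ℓ) (C : QSym ℓ → Set) (adm : Admissible k C) where
  open Coefficients {ℓ}
  open Slices {ℓ}
  open Components {ℓ}

  has-[] : C []
  has-[] = proj₁ (proj₂ (proj₁ adm))

  has-++ : ∀ h g → C h → C g → C (h ++ g)
  has-++ = proj₁ (proj₂ (proj₂ (proj₁ adm)))

  has-scale : ∀ a h → C h → C (scale a h)
  has-scale = proj₂ (proj₂ (proj₂ (proj₁ adm)))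

  leftSlice-in-C : ∀ J ps → All (λ p → C (proj₁ p) × C (proj₂ p)) ps → C (leftSlice J ps)
  leftSlice-in-C J [] [] = has-[]
  leftSlice-in-C J ((c , d) ∷ ps) ((_ , Cd) ∷ inC) =
    has-++ _ _ (has-scale (coeff c J) d Cd) (leftSlice-in-C J ps inC)

  rightSlice-in-C : ∀ K ps → All (λ p → C (proj₁ p) × C (proj₂ p)) ps → C (rightSlice K ps)
  rightSlice-in-C K [] [] = has-[]
  rightSlice-in-C K ((c , d) ∷ ps) ((Cc , _) ∷ inC) =
    has-++ _ _ (has-scale (coeff d K) c Cc) (rightSlice-in-C K ps inC)

  two-sided-slice : ∀ h → C h → ∀ P Q →
    Σ (QSym ℓ) λ g → C g × (∀ X → coeff g X ≡ coeff h (P ++ X ++ Q))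
  two-sided-slice h Ch P Q =
    let (ps , inC , Δh≃) = coalgebra h Ch
        g₁ = leftSlice P ps
        (qs , inC₁ , Δg₁≃) = coalgebra g₁ (leftSlice-in-C P ps inC)
    in rightSlice Q qs , rightSlice-in-C Q qs inC₁ , λ X →
         trans (rightSlice-Δ g₁ qs Δg₁≃ X Q) (leftSlice-Δ h ps Δh≃ P (X ++ Q))
    where coalgebra = proj₁ (proj₂ (proj₂ adm))

  self-negating : ∀ c → - 1ℚ * c ≡ c → c ≡ 0ℚ
  self-negating c e =
    trans (solve 1 (λ c → c := con ½ :* (c :+ c)) refl c)
    (trans (cong (λ z → ½ * (c + z)) (sym e))
           (solve 1 (λ c → con ½ :* (c :+ (:- con 1ℚ) :* c) := con 0ℚ) refl c))

  odd-letter-absent : ∀ g → C g → (i : Letter ℓ) → proj₁ i ≤ᵛ k → Odd ∣ proj₁ i ∣ᵛ →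
    coeff g (i ∷ []) ≡ 0ℚ
  odd-letter-absent g Cg i i≤k odd =
    trans (sym (ζ-letter-component i g)) (self-negating (ζQ gᵢ) ζ-self-negating)
    where
      graded = proj₁ (proj₂ adm)
      zeta   = proj₂ (proj₂ (proj₂ adm))
      gᵢ     = component (proj₁ i) g

      ζ-self-negating : - 1ℚ * ζQ gᵢ ≡ ζQ gᵢ
      ζ-self-negating = begin
        - 1ℚ * ζQ gᵢ                     ≡⟨ cong (_* ζQ gᵢ) (sym (odd⇒sign ∣ proj₁ i ∣ᵛ odd)) ⟩
        negOnePow ∣ proj₁ i ∣ᵛ * ζQ gᵢ   ≡⟨ sym (ζ̄-component (proj₁ i) g) ⟩
        ζ̄Q gᵢ                            ≡⟨ zeta (proj₁ i) gᵢ i≤k (component-homogeneous (proj₁ i) g)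
                                                 (graded (proj₁ i) g Cg) ⟩
        ζQ gᵢ                            ∎
        where open ≡-Reasoning

  occurring-good : ∀ h → C h → ∀ P Q → coeff h (P ++ Q) ≢ 0ℚ → GoodComp k Q
  occurring-good h Ch P [] _ = []
  occurring-good h Ch P (i ∷ Q) c≢0 =
    letter-even ∷ occurring-good h Ch (P ++ i ∷ []) Q
                    (subst (λ X → coeff h X ≢ 0ℚ) (sym (ListP.++-assoc P (i ∷ []) Q)) c≢0)
    where
      letter-even : proj₁ i ≤ᵛ k → Even ∣ proj₁ i ∣ᵛ
      letter-even i≤k with parity ∣ proj₁ i ∣ᵛ
      ... | inj₁ (even , _) = even
      ... | inj₂ (odd , _)  =
        let (g , Cg , slice) = two-sided-slice h Ch P Q
        in ⊥-elim (c≢0 (trans (sym (slice (i ∷ []))) (odd-letter-absent g Cg i i≤k odd)))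

  maximal : ∀ h → C h → EvenSpan k h
  maximal h Ch I c≢0 = occurring-good h Ch [] I c≢0

theorem5p22 : (ℓ : ℕ) → 1 ≤ ℓ → (k : Vec ℕ∞ ℓ) →
    ((x : NSym ℓ) → (InIdeal (GenIE k) x → InIdeal (GenOdd k) x)
                  × (InIdeal (GenOdd k) x → InIdeal (GenIE k) x))
    × IsLargestAdmissible k (EvenSpan k)
theorem5p22 ℓ _ k =
    Ideals.ideal-generators k
  , EvenSpanAdmissible.admissible k
  , λ C adm → Maximality.maximal k C adm
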